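{- If $\vdash A_1^{*\infty},\ldots,A_n^{*\infty}$ is derivable in $\mathtt{ALV}$, then $\mathtt{CL}$ derives $\vdash A_1,\ldots,A_n$.
   Context: $\mathtt{CL}$ is Tait-style classical propositional logic (initial sequents $\vdash\Gamma,P,\overline{P}$; $\wedge$: from $\vdash\Gamma,A$ and $\vdash\Gamma,B$ infer $\vdash\Gamma,A\wedge B$; $\vee$: from $\vdash\Gamma,A,B$ infer $\vdash\Gamma,A\vee B$), in which contraction is height-preserving admissible. $\mathtt{ALV}$ is affine logic (one-sided calculus with initial sequents $\vdash\Gamma,P,\overline{P}$ and rules for $\oplus$, $\&$ (additive conjunction), $⅋$ (multiplicative disjunction), $\otimes$, $\forall$, $\exists$, no contraction) extended, for possibly infinite multisets, with vacuous quantifier rules: from $\vdash\Gamma,A^\infty$ infer $\vdash\Gamma,\exists xA$; from $\vdash\Gamma_i,A$ for all $i$ infer $\vdash\biguplus_i\Gamma_i,\forall xA$ ($A^\infty$ = infinitely many copies of $A$; $x$ not free in $A$). The translation $*$: $P^*=P$, $\overline{P}^*=\overline{P}$, $(A\vee B)^*=\exists xA^*⅋\exists yB^*$, $(A\wedge B)^*=\exists xA^*\otimes\exists yB^*$, with vacuous quantifiers; $A^{*\infty}$ is infinitely many copies of $A^*$. -}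

module Defs where

open import Data.Nat using (ℕ)
open import Data.Fin using (Fin)
open import Data.Maybe using (Maybe; just; nothing)
open import Data.Sum using (_⊎_; inj₁; inj₂)
open import Data.Product using (Σ; _×_; _,_)
open import Data.List using (List; _∷_; tabulate)
open import Data.List.Relation.Binary.Permutation.Propositional using (_↭_)
open import Function.Bundles using (_↔_; Inverse)
open import Relation.Binary.PropositionalEquality using (_≡_)

data Fml : Set where
  pos neg : ℕ → Fml
  _∧_ _∨_ : Fml → Fml → Fml

-- Sequents of CL are finite multisets, represented by lists up to
-- permutation (the `exch` rule).
data CL : List Fml → Set where
  ax   : ∀ (Γ : List Fml) (P : ℕ) → CL (pos P ∷ neg P ∷ Γ)
  ∧R   : ∀ {Γ A B} → CL (A ∷ Γ) → CL (B ∷ Γ) → CL ((A ∧ B) ∷ Γ)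
  ∨R   : ∀ {Γ A B} → CL (A ∷ B ∷ Γ) → CL ((A ∨ B) ∷ Γ)
  exch : ∀ {Γ Δ} → Γ ↭ Δ → CL Γ → CL Δ

data LFml : Set where
  lpos lneg         : ℕ → LFml
  _⊕_ _&_ _⅋_ _⊗_   : LFml → LFml → LFml
  ∀v ∃v             : LFml → LFml   -- vacuous ∀x A, ∃x A

-- Possibly infinite multisets: families indexed by an arbitrary type,
-- considered up to bijection of the index type (rule `perm`).
record Seq : Set₁ where
  constructor seq
  field
    Ix : Set
    fm : Ix → LFml
open Seq public

_,,_ : Seq → LFml → Seq
Γ ,, A = seq (Maybe (Ix Γ)) λ { (just i) → fm Γ i ; nothing → A }

_⊎ˢ_ : Seq → Seq → Seq
Γ ⊎ˢ Δ = seq (Ix Γ ⊎ Ix Δ) λ { (inj₁ i) → fm Γ i ; (inj₂ j) → fm Δ j }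

⨄ : (ℕ → Seq) → Seq
⨄ Γs = seq (Σ ℕ λ i → Ix (Γs i)) λ { (i , j) → fm (Γs i) j }

_^∞ : LFml → Seq
A ^∞ = seq ℕ λ _ → A

_≈ˢ_ : Seq → Seq → Set
Γ ≈ˢ Δ = Σ (Ix Γ ↔ Ix Δ) λ e → ∀ i → fm Δ (Inverse.to e i) ≡ fm Γ i

data ALV : Seq → Set₁ where
  ax   : ∀ (Γ : Seq) (P : ℕ) → ALV ((Γ ,, lpos P) ,, lneg P)
  ⊕R₁  : ∀ {Γ A B} → ALV (Γ ,, A) → ALV (Γ ,, (A ⊕ B))
  ⊕R₂  : ∀ {Γ A B} → ALV (Γ ,, B) → ALV (Γ ,, (A ⊕ B))
  &R   : ∀ {Γ A B} → ALV (Γ ,, A) → ALV (Γ ,, B) → ALV (Γ ,, (A & B))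
  ⅋R   : ∀ {Γ A B} → ALV ((Γ ,, A) ,, B) → ALV (Γ ,, (A ⅋ B))
  ⊗R   : ∀ {Γ Δ A B} → ALV (Γ ,, A) → ALV (Δ ,, B) → ALV ((Γ ⊎ˢ Δ) ,, (A ⊗ B))
  -- ordinary quantifier rules (x not free in A, so A[t/x] = A and the
  -- eigenvariable condition is trivially met)
  ∀R   : ∀ {Γ A} → ALV (Γ ,, A) → ALV (Γ ,, ∀v A)
  ∃R   : ∀ {Γ A} → ALV (Γ ,, A) → ALV (Γ ,, ∃v A)
  ∃∞R  : ∀ {Γ A} → ALV (Γ ⊎ˢ (A ^∞)) → ALV (Γ ,, ∃v A)
  ∀∞R  : ∀ {A} (Γs : ℕ → Seq) → (∀ i → ALV (Γs i ,, A)) → ALV (⨄ Γs ,, ∀v A)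
  perm : ∀ {Γ Δ} → Γ ≈ˢ Δ → ALV Γ → ALV Δ

_* : Fml → LFml
pos P *   = lpos P
neg P *   = lneg P
(A ∨ B) * = ∃v (A *) ⅋ ∃v (B *)
(A ∧ B) * = ∃v (A *) ⊗ ∃v (B *)

starInf : ∀ {n} → (Fin n → Fml) → Seq
starInf {n} A = seq (Fin n × ℕ) λ { (i , _) → A i * }

fmls : ∀ {n} → (Fin n → Fml) → List Fml
fmls A = tabulate A

{-# OPTIONS --safe #-}
-- Read ⊕ and ⅋ as ∨, & and ⊗ as ∧, and the vacuous quantifiers as nothing. Under this
-- two-valued reading every ALV-derivable sequent, however infinite, contains a true formula
-- (one premise of the infinitary ∀ rule suffices), and A* has the truth value of A; so a
-- derivation of A₁^{*∞}, …, Aₙ^{*∞} makes A₁, …, Aₙ valid. CL is complete: its rules are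
-- invertible, so decomposition reaches sequents of literals, and a sequent of literals
-- without a complementary pair is falsified by making exactly its negated atoms true.
module Submission where

open import Defs
open import Data.Nat using (ℕ; suc; _+_; _≤_; s≤s; _≟_)
open import Data.Nat.Properties using (≤-refl; ≤-trans; ≤-reflexive; +-monoˡ-≤; m≤m+n; m≤n+m; +-assoc)
open import Data.Fin using (Fin)
open import Data.Bool using (Bool; true; false; T; not) renaming (_∧_ to _&&_; _∨_ to _||_)
open import Data.Bool.Properties using (T-∧; T-∨)
open import Data.Maybe using (just; nothing)
open import Data.Sum using (_⊎_; inj₁; inj₂; [_,_]′)
open import Data.Product using (Σ; ∃; _,_; proj₁; proj₂)
open import Data.Empty using (⊥-elim)
open import Data.List using (List; []; _∷_; _++_; map)
open import Data.Nat.ListAction using (sum)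
open import Data.List.Properties using (++-identityʳ)
open import Data.List.Relation.Unary.Any using (Any; here; there)
open import Data.List.Relation.Unary.Any.Properties using (tabulate⁺; map⁻; ++⁺ˡ; ++⁺ʳ)
open import Data.List.Membership.Propositional using (_∈_; find)
open import Data.List.Membership.Propositional.Properties using (∈-map⁺)
open import Data.List.Membership.DecPropositional _≟_ using (_∈?_)
open import Data.List.Relation.Binary.Permutation.Propositional using (_↭_; ↭-refl; ↭-sym; ↭-trans; prep; swap)
open import Data.List.Relation.Binary.Permutation.Propositional.Properties using (Any-resp-↭; shift)
open import Relation.Nullary using (yes; no; isYes)
open import Relation.Nullary.Decidable using (T?; toWitness; toWitnessFalse)
open import Relation.Binary.PropositionalEquality using (_≡_; refl; sym; cong₂; subst)
open import Function using (_∘_; id)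
open import Function.Bundles using (Inverse; Equivalence)

T-or-T-not : ∀ b → T b ⊎ T (not b)
T-or-T-not true  = inj₁ _
T-or-T-not false = inj₂ _

T-∧-intro : ∀ {a b} → T a → T b → T (a && b)
T-∧-intro a b = Equivalence.from T-∧ (a , b)

T-∨-introˡ : ∀ {a b} → T a → T (a || b)
T-∨-introˡ a = Equivalence.from T-∨ (inj₁ a)

T-∨-introʳ : ∀ {a b} → T b → T (a || b)
T-∨-introʳ b = Equivalence.from T-∨ (inj₂ b)

Valuation : Set
Valuation = ℕ → Bool

⟦_⟧ : Fml → Valuation → Bool
⟦ pos P ⟧ v = v P
⟦ neg P ⟧ v = not (v P)
⟦ A ∧ B ⟧ v = ⟦ A ⟧ v && ⟦ B ⟧ v
⟦ A ∨ B ⟧ v = ⟦ A ⟧ v || ⟦ B ⟧ v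

⟦_⟧ˡ : LFml → Valuation → Bool
⟦ lpos P ⟧ˡ v = v P
⟦ lneg P ⟧ˡ v = not (v P)
⟦ A ⊕ B ⟧ˡ v = ⟦ A ⟧ˡ v || ⟦ B ⟧ˡ v
⟦ A & B ⟧ˡ v = ⟦ A ⟧ˡ v && ⟦ B ⟧ˡ v
⟦ A ⅋ B ⟧ˡ v = ⟦ A ⟧ˡ v || ⟦ B ⟧ˡ v
⟦ A ⊗ B ⟧ˡ v = ⟦ A ⟧ˡ v && ⟦ B ⟧ˡ v
⟦ ∀v A ⟧ˡ v = ⟦ A ⟧ˡ v
⟦ ∃v A ⟧ˡ v = ⟦ A ⟧ˡ v

⟦*⟧ : ∀ A v → ⟦ A * ⟧ˡ v ≡ ⟦ A ⟧ v
⟦*⟧ (pos P) v = refl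
⟦*⟧ (neg P) v = refl
⟦*⟧ (A ∧ B) v = cong₂ _&&_ (⟦*⟧ A v) (⟦*⟧ B v)
⟦*⟧ (A ∨ B) v = cong₂ _||_ (⟦*⟧ A v) (⟦*⟧ B v)

SomeHolds : Valuation → Seq → Set
SomeHolds v Γ = Σ (Ix Γ) λ i → T (⟦ fm Γ i ⟧ˡ v)

module _ {v : Valuation} where

  side : ∀ {Γ A} → SomeHolds v Γ → SomeHolds v (Γ ,, A)
  side (i , h) = just i , h

  principal : ∀ {Γ A} → T (⟦ A ⟧ˡ v) → SomeHolds v (Γ ,, A)
  principal h = nothing , h

  split : ∀ {Γ A} → SomeHolds v (Γ ,, A) → SomeHolds v Γ ⊎ T (⟦ A ⟧ˡ v)
  split (just i , h)  = inj₁ (i , h)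
  split (nothing , h) = inj₂ h

  replace : ∀ {Γ A C} → (T (⟦ A ⟧ˡ v) → T (⟦ C ⟧ˡ v)) →
            SomeHolds v (Γ ,, A) → SomeHolds v (Γ ,, C)
  replace f = [ side , principal ∘ f ]′ ∘ split

  left : ∀ {Γ Δ} → SomeHolds v Γ → SomeHolds v (Γ ⊎ˢ Δ)
  left (i , h) = inj₁ i , h

  right : ∀ {Γ Δ} → SomeHolds v Δ → SomeHolds v (Γ ⊎ˢ Δ)
  right (j , h) = inj₂ j , h

  ALV-sound : ∀ {Γ} → ALV Γ → SomeHolds v Γ
  ALV-sound (ax Γ P) = [ side ∘ principal , principal ]′ (T-or-T-not (v P))
  ALV-sound (⊕R₁ d) = replace T-∨-introˡ (ALV-sound d)
  ALV-sound (⊕R₂ d) = replace T-∨-introʳ (ALV-sound d)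
  ALV-sound (&R d e) =
    [ side , (λ a → replace (T-∧-intro a) (ALV-sound e)) ]′ (split (ALV-sound d))
  ALV-sound (⅋R d) =
    [ replace T-∨-introˡ , principal ∘ T-∨-introʳ ]′ (split (ALV-sound d))
  ALV-sound (⊗R d e) =
    [ side ∘ left
    , (λ a → [ side ∘ right , principal ∘ T-∧-intro a ]′ (split (ALV-sound e)))
    ]′ (split (ALV-sound d))
  ALV-sound (∀R d) = replace id (ALV-sound d)
  ALV-sound (∃R d) = replace id (ALV-sound d)
  ALV-sound (∃∞R d) with ALV-sound d
  ... | inj₁ i , h = just i , h
  ... | inj₂ _ , h = nothing , h
  ALV-sound (∀∞R {A} Γs ds) with T? (⟦ A ⟧ˡ v)
  ... | yes a = principal a
  ... | no ¬a = [ (λ { (j , h) → just (0 , j) , h }) , ⊥-elim ∘ ¬a ]′ (split (ALV-sound (ds 0)))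
  ALV-sound (perm (e , same) d) with ALV-sound d
  ... | i , h = Inverse.to e i , subst (λ B → T (⟦ B ⟧ˡ v)) (sym (same i)) h

Holds : Valuation → Fml → Set
Holds v A = T (⟦ A ⟧ v)

Valid : List Fml → Set
Valid Γ = ∀ v → Any (Holds v) Γ

∈⇒↭-head : ∀ {A : Fml} {Γ} → A ∈ Γ → ∃ λ Δ → Γ ↭ A ∷ Δ
∈⇒↭-head (here refl) = _ , ↭-refl
∈⇒↭-head {Γ = B ∷ _} (there A∈Γ) with ∈⇒↭-head A∈Γ
... | Δ , Γ↭A∷Δ = B ∷ Δ , ↭-trans (prep B Γ↭A∷Δ) (swap B _ ↭-refl)

CL-ax-∈ : ∀ {P Γ} → pos P ∈ Γ → neg P ∈ Γ → CL Γ
CL-ax-∈ {P} P∈Γ P̄∈Γ with ∈⇒↭-head P∈Γ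
... | Δ , Γ↭P∷Δ with Any-resp-↭ Γ↭P∷Δ P̄∈Γ
... | there P̄∈Δ with ∈⇒↭-head P̄∈Δ
... | Θ , Δ↭P̄∷Θ = exch (↭-sym (↭-trans Γ↭P∷Δ (prep (pos P) Δ↭P̄∷Θ))) (ax Θ P)

data Literal : Set where
  ⁺ ⁻ : ℕ → Literal

lit : Literal → Fml
lit (⁺ P) = pos P
lit (⁻ P) = neg P

lits : List Literal → List Fml
lits = map lit

negatedAtoms : List Literal → List ℕ
negatedAtoms []        = []
negatedAtoms (⁺ _ ∷ L) = negatedAtoms L
negatedAtoms (⁻ P ∷ L) = P ∷ negatedAtoms L

∈-negatedAtoms⁺ : ∀ {P L} → ⁻ P ∈ L → P ∈ negatedAtoms L
∈-negatedAtoms⁺ {L = ⁻ _ ∷ _} (here refl) = here refl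
∈-negatedAtoms⁺ {L = ⁺ _ ∷ _} (there m)   = ∈-negatedAtoms⁺ m
∈-negatedAtoms⁺ {L = ⁻ _ ∷ _} (there m)   = there (∈-negatedAtoms⁺ m)

∈-negatedAtoms⁻ : ∀ {P} L → P ∈ negatedAtoms L → ⁻ P ∈ L
∈-negatedAtoms⁻ (⁺ _ ∷ L) m           = there (∈-negatedAtoms⁻ L m)
∈-negatedAtoms⁻ (⁻ _ ∷ L) (here refl) = here refl
∈-negatedAtoms⁻ (⁻ _ ∷ L) (there m)   = there (∈-negatedAtoms⁻ L m)

countermodel : List Literal → Valuation
countermodel L P = isYes (P ∈? negatedAtoms L)

CL-complete-literals : ∀ L → Valid (lits L) → CL (lits L)
CL-complete-literals L valid with find (map⁻ (valid (countermodel L)))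
... | ⁺ P , P∈L , h = CL-ax-∈ (∈-map⁺ lit P∈L) (∈-map⁺ lit (∈-negatedAtoms⁻ L (toWitness h)))
... | ⁻ P , P̄∈L , h = ⊥-elim (toWitnessFalse h (∈-negatedAtoms⁺ P̄∈L))

size : Fml → ℕ
size (pos _) = 1
size (neg _) = 1
size (A ∧ B) = suc (size A + size B)
size (A ∨ B) = suc (size A + size B)

sizes : List Fml → ℕ
sizes = sum ∘ map size

sizes-∧ˡ : ∀ A B Γ → sizes (A ∷ Γ) ≤ size A + size B + sizes Γ
sizes-∧ˡ A B Γ = +-monoˡ-≤ (sizes Γ) (m≤m+n (size A) (size B))

sizes-∧ʳ : ∀ A B Γ → sizes (B ∷ Γ) ≤ size A + size B + sizes Γ
sizes-∧ʳ A B Γ = +-monoˡ-≤ (sizes Γ) (m≤n+m (size B) (size A))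

sizes-∨ : ∀ A B Γ → sizes (A ∷ B ∷ Γ) ≤ size A + size B + sizes Γ
sizes-∨ A B Γ = ≤-reflexive (sym (+-assoc (size A) (size B) (sizes Γ)))

Valid-invert : ∀ {C} Δ {Γ} → (∀ v → Holds v C → Any (Holds v) Δ) → Valid (C ∷ Γ) → Valid (Δ ++ Γ)
Valid-invert Δ inv valid v with valid v
... | here h  = ++⁺ˡ (inv v h)
... | there a = ++⁺ʳ Δ a

Valid-∧ˡ : ∀ {A B Γ} → Valid ((A ∧ B) ∷ Γ) → Valid (A ∷ Γ)
Valid-∧ˡ = Valid-invert (_ ∷ []) λ _ → here ∘ proj₁ ∘ Equivalence.to T-∧

Valid-∧ʳ : ∀ {A B Γ} → Valid ((A ∧ B) ∷ Γ) → Valid (B ∷ Γ)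
Valid-∧ʳ = Valid-invert (_ ∷ []) λ _ → here ∘ proj₂ ∘ Equivalence.to T-∧

Valid-∨ : ∀ {A B Γ} → Valid ((A ∨ B) ∷ Γ) → Valid (A ∷ B ∷ Γ)
Valid-∨ = Valid-invert (_ ∷ _ ∷ []) λ _ → [ here , there ∘ here ]′ ∘ Equivalence.to T-∨

shelve : ∀ l Γ L → (Valid (Γ ++ lits (l ∷ L)) → CL (Γ ++ lits (l ∷ L))) →
         Valid (lit l ∷ Γ ++ lits L) → CL (lit l ∷ Γ ++ lits L)
shelve l Γ L complete valid =
  exch (shift (lit l) Γ (lits L)) (complete (Any-resp-↭ (↭-sym (shift (lit l) Γ (lits L))) ∘ valid))

-- L collects the literals reached so far; n is fuel bounding the size of what is left to decompose.
CL-complete-with : ∀ n Γ L → sizes Γ ≤ n → Valid (Γ ++ lits L) → CL (Γ ++ lits L)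
CL-complete-with n       []            L _ = CL-complete-literals L
CL-complete-with (suc n) (pos P ∷ Γ)   L (s≤s Γ≤n) = shelve (⁺ P) Γ L (CL-complete-with n Γ (⁺ P ∷ L) Γ≤n)
CL-complete-with (suc n) (neg P ∷ Γ)   L (s≤s Γ≤n) = shelve (⁻ P) Γ L (CL-complete-with n Γ (⁻ P ∷ L) Γ≤n)
CL-complete-with (suc n) ((A ∧ B) ∷ Γ) L (s≤s ≤n) valid =
  ∧R (CL-complete-with n (A ∷ Γ) L (≤-trans (sizes-∧ˡ A B Γ) ≤n) (Valid-∧ˡ valid))
     (CL-complete-with n (B ∷ Γ) L (≤-trans (sizes-∧ʳ A B Γ) ≤n) (Valid-∧ʳ valid))
CL-complete-with (suc n) ((A ∨ B) ∷ Γ) L (s≤s ≤n) valid =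
  ∨R (CL-complete-with n (A ∷ B ∷ Γ) L (≤-trans (sizes-∨ A B Γ) ≤n) (Valid-∨ valid))

CL-complete : ∀ Γ → Valid Γ → CL Γ
CL-complete Γ valid = subst CL (++-identityʳ Γ)
  (CL-complete-with (sizes Γ) Γ [] ≤-refl (subst Valid (sym (++-identityʳ Γ)) valid))

mainTheorem10 : (n : ℕ) (A : Fin n → Fml) → ALV (starInf A) → CL (fmls A)
mainTheorem10 n A d = CL-complete (fmls A) λ v →
  let (i , _) , h = ALV-sound {v} d in tabulate⁺ i (subst T (⟦*⟧ (A i) v) h)
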